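{- Let $w$ be a lower Christoffel word over $\{a,b\}$ and let $\tilde w$ be the corresponding upper Christoffel word (the reversal of $w$). Let $S_w\subseteq\mathbb Z^2$ be the set of integer points lying on the lattice paths associated with $w$ and with $\tilde w$. Then $S_w$ equals the support $\{(i,j)\in\mathbb N^2:\delta_w(i,j)>0\}$ of $\delta_w$.
   Context: Words are finite words over $\{a,b\}$; a factor of $w$ is a contiguous subword (including the empty word and $w$ itself). The Parikh image of $x$ is $(|x|_a,|x|_b)$, and $\delta_w(i,j)$ is the number of distinct factors of $w$ with Parikh image $(i,j)$. A palindrome is a word equal to its reversal. A lower Christoffel word is $a$, $b$, or a word of the form $amb$ where $m$ is a palindrome and $amb$ is a product of two palindromes; the corresponding upper Christoffel word is its reversal $\tilde w$ (so $bma$ when $w=amb$). With each word $x$ one associates the lattice path in the plane starting at the origin in which each letter $a$ is a unit step East and each letter $b$ a unit step North; the integer points on this path are exactly the points $(|y|_a,|y|_b)$ for $y$ ranging over the prefixes of $x$. -}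

module Defs where

open import Data.Nat using (ℕ; zero; suc; _<_)
open import Data.Integer using (ℤ; +_)
open import Data.Product using (_×_; _,_; Σ; ∃-syntax)
open import Data.Sum using (_⊎_)
open import Data.List using (List; []; _∷_; _++_; reverse; inits; tails; concatMap; filter; length; map; deduplicate; [_])
open import Data.List.Properties using (≡-dec)
open import Data.List.Membership.Propositional using (_∈_)
open import Data.Product.Properties using () renaming (≡-dec to ×-≡-dec)
open import Data.Nat.Properties using () renaming (_≟_ to _≟ℕ_)
open import Relation.Binary.PropositionalEquality using (_≡_; refl)
open import Relation.Nullary using (yes; no)
open import Relation.Binary using (DecidableEquality)

data Letter : Set where
  a b : Letter

_≟L_ : DecidableEquality Letter
a ≟L a = yes refl
a ≟L b = no (λ ())
b ≟L a = no (λ ())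
b ≟L b = yes refl

Word : Set
Word = List Letter

_≟W_ : DecidableEquality Word
_≟W_ = ≡-dec _≟L_

count : Letter → Word → ℕ
count c [] = 0
count c (d ∷ x) with c ≟L d
... | yes _ = suc (count c x)
... | no _  = count c x

parikh : Word → ℕ × ℕ
parikh x = count a x , count b x

Palindrome : Word → Set
Palindrome w = reverse w ≡ w

IsLowerChristoffel : Word → Set
IsLowerChristoffel w =
  (w ≡ [ a ]) ⊎ (w ≡ [ b ]) ⊎
  (Σ Word λ m → Palindrome m × w ≡ a ∷ (m ++ [ b ]) ×
     Σ Word λ p → Σ Word λ q → Palindrome p × Palindrome q × w ≡ p ++ q)

allFactors : Word → List Word
allFactors w = concatMap inits (tails w)

δ : Word → ℕ → ℕ → ℕ
δ w i j = length (deduplicate _≟W_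
  (filter (λ x → ×-≡-dec _≟ℕ_ _≟ℕ_ (parikh x) (i , j)) (allFactors w)))

-- Integer points of the lattice path of x: the Parikh images of prefixes of x
pathPoints : Word → List (ℤ × ℤ)
pathPoints x = map (λ y → (+ count a y , + count b y)) (inits x)

InS : Word → ℤ × ℤ → Set
InS w p = (p ∈ pathPoints w) ⊎ (p ∈ pathPoints (reverse w))

InSupport : Word → ℤ × ℤ → Set
InSupport w p = ∃[ i ] ∃[ j ] (p ≡ (+ i , + j) × 0 < δ w i j)

-- Let h w i be the number of letters b in the prefix of length i of w, the height of the
-- lattice path of w after i steps. For a lower Christoffel word w of length n, h w is almost
-- additive, h i + h j ≤ h (i + j) ≤ h i + h j + 1, and for 0 < j < n the suffix of length j
-- contains exactly h j + 1 letters b. Both facts are proved by induction along the standard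
-- factorization w = x y into two shorter lower Christoffel words, which is extracted from the
-- decomposition of w into two palindromes. Hence a factor of length k starting after position i
-- contains h (i + k) − h i ∈ {h k, h k + 1} letters b, so it has the Parikh vector of the prefix
-- of length k either of w or of its reversal. Conversely every point of either path is the Parikh
-- vector of a prefix of w or of a reversed suffix of w.

module Submission where

open import Defs
open import Data.Nat using (ℕ; zero; suc; _+_; _∸_; _≤_; _<_; z≤n; s≤s; z<s; _≤?_; _≟_)
open import Data.Nat.Properties
open import Algebra.Properties.CommutativeSemigroup +-commutativeSemigroup using (x∙yz≈y∙xz)
open import Data.Nat.Induction using (<-wellFounded)
open import Induction.WellFounded using (Acc; acc)
open import Data.Integer as ℤ using (ℤ)
open import Data.Product using (_×_; _,_; proj₁; proj₂; ∃-syntax)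
open import Data.Product.Properties using () renaming (≡-dec to ×-≡-dec)
open import Data.Sum using (_⊎_; inj₁; inj₂)
open import Data.List
  using (List; []; _∷_; _++_; reverse; length; take; [_]; _∷ʳ_; initLast; _∷ʳ′_; inits; tails; map; filter; deduplicate)
open import Data.List.Properties
  using ( ++-assoc; ++-identityʳ; ++-cancelʳ; ∷-injective; ∷-injectiveˡ; ∷-injectiveʳ; ∷ʳ-injectiveˡ
        ; reverse-++; reverse-involutive; unfold-reverse; length-++; length-reverse; take-all)
open import Data.List.Membership.Propositional using (_∈_)
open import Data.List.Membership.Propositional.Properties
  using (∈-map⁺; ∈-map⁻; ∈-concat⁺′; ∈-concat⁻′; ∈-filter⁺; ∈-filter⁻)
open import Data.List.Relation.Unary.Any using (here; there)
open import Relation.Binary.PropositionalEquality hiding ([_])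
open import Relation.Nullary using (Dec; yes; no; contradiction)

private
  variable
    A : Set

++-overlap : ∀ (x y x′ y′ : List A) → x ++ y ≡ x′ ++ y′ →
  (∃[ s ] x′ ≡ x ++ s × y ≡ s ++ y′) ⊎ (∃[ s ] x ≡ x′ ++ s × y′ ≡ s ++ y)
++-overlap [] y x′ y′ eq = inj₁ (x′ , refl , eq)
++-overlap (c ∷ x) y [] y′ eq = inj₂ (c ∷ x , refl , sym eq)
++-overlap (c ∷ x) y (c′ ∷ x′) y′ eq with ∷-injective eq
... | refl , eq′ with ++-overlap x y x′ y′ eq′
...   | inj₁ (s , x′≡x++s , y≡s++y′) = inj₁ (s , cong (c ∷_) x′≡x++s , y≡s++y′)
...   | inj₂ (s , x≡x′++s , y′≡s++y) = inj₂ (s , cong (c ∷_) x≡x′++s , y′≡s++y)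

take-++-≤ : ∀ k (x y : List A) → k ≤ length x → take k (x ++ y) ≡ take k x
take-++-≤ zero x y _ = refl
take-++-≤ (suc k) (c ∷ x) y (s≤s k≤x) = cong (c ∷_) (take-++-≤ k x y k≤x)

take-++-+ : ∀ (x y : List A) j → take (length x + j) (x ++ y) ≡ x ++ take j y
take-++-+ [] y j = refl
take-++-+ (c ∷ x) y j = cong (c ∷_) (take-++-+ x y j)

take-length-++ : ∀ (x y : List A) → take (length x) (x ++ y) ≡ x
take-length-++ x y = trans (take-++-≤ (length x) x y ≤-refl) (take-all (length x) x ≤-refl)

splitAt-≤ : ∀ k (w : List A) → k ≤ length w → ∃[ x ] ∃[ y ] w ≡ x ++ y × length x ≡ k
splitAt-≤ zero w _ = [] , w , refl , refl
splitAt-≤ (suc k) (c ∷ w) (s≤s k≤w) with splitAt-≤ k w k≤w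
... | x , y , refl , refl = c ∷ x , y , refl , refl

length-infix : ∀ (α x β : List A) → length α + length x ≤ length (α ++ x ++ β)
length-infix α x β = subst (length α + length x ≤_) (sym (length-++ α))
  (+-monoʳ-≤ (length α) (subst (length x ≤_) (sym (length-++ x)) (m≤m+n (length x) (length β))))

length-wrap : ∀ (c : A) u d → length (c ∷ u ++ [ d ]) ≡ suc (suc (length u))
length-wrap c u d = cong suc (trans (length-++ u) (+-comm (length u) 1))

wrap-injective : ∀ {c d : A} {x y} → c ∷ x ++ [ d ] ≡ c ∷ y ++ [ d ] → x ≡ y
wrap-injective {x = x} {y} eq = ∷ʳ-injectiveˡ x y (∷-injectiveʳ eq)

++-∷-∷-regroup : ∀ (x : List A) c d y →
  (x ++ c ∷ d ∷ y) ++ [ d ] ≡ (x ++ [ c ]) ++ d ∷ y ++ [ d ]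
++-∷-∷-regroup x c d y =
  trans (++-assoc x (c ∷ d ∷ y) [ d ]) (sym (++-assoc x [ c ] (d ∷ y ++ [ d ])))

reverse-wrap : ∀ (c : A) u d → reverse (c ∷ u ++ [ d ]) ≡ d ∷ reverse u ++ [ c ]
reverse-wrap c u d = trans (unfold-reverse c (u ++ [ d ])) (cong (_∷ʳ c) (reverse-++ u [ d ]))

reverse-++-∷-∷ : ∀ (u : List A) c d v →
  reverse (u ++ c ∷ d ∷ v) ≡ reverse v ++ d ∷ c ∷ reverse u
reverse-++-∷-∷ u c d v = begin
  reverse (u ++ c ∷ d ∷ v)                 ≡⟨ reverse-++ u (c ∷ d ∷ v) ⟩
  reverse (c ∷ d ∷ v) ++ reverse u         ≡⟨ cong (_++ reverse u) (reverse-++ (c ∷ d ∷ []) v) ⟩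
  (reverse v ++ d ∷ c ∷ []) ++ reverse u   ≡⟨ ++-assoc (reverse v) (d ∷ c ∷ []) (reverse u) ⟩
  reverse v ++ d ∷ c ∷ reverse u           ∎
  where open ≡-Reasoning

++∈inits : ∀ (x y : List A) → x ∈ inits (x ++ y)
++∈inits [] y = here refl
++∈inits (c ∷ x) y = there (∈-map⁺ (c ∷_) (++∈inits x y))

∈inits⇒++ : ∀ {x : List A} w → x ∈ inits w → ∃[ y ] w ≡ x ++ y
∈inits⇒++ w (here refl) = w , refl
∈inits⇒++ (c ∷ w) (there x∈) with ∈-map⁻ (c ∷_) x∈
... | x′ , x′∈ , refl with ∈inits⇒++ w x′∈
...   | y , refl = y , refl

++∈tails : ∀ (x y : List A) → y ∈ tails (x ++ y)
++∈tails [] y = here refl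
++∈tails (c ∷ x) y = there (++∈tails x y)

∈tails⇒++ : ∀ {y : List A} w → y ∈ tails w → ∃[ x ] w ≡ x ++ y
∈tails⇒++ w (here refl) = [] , refl
∈tails⇒++ (c ∷ w) (there y∈) with ∈tails⇒++ w y∈
... | x , refl = c ∷ x , refl

count-++ : ∀ c (x y : Word) → count c (x ++ y) ≡ count c x + count c y
count-++ c [] y = refl
count-++ a (a ∷ x) y = cong suc (count-++ a x y)
count-++ a (b ∷ x) y = count-++ a x y
count-++ b (a ∷ x) y = count-++ b x y
count-++ b (b ∷ x) y = cong suc (count-++ b x y)

count-reverse : ∀ c (x : Word) → count c (reverse x) ≡ count c x
count-reverse c [] = refl
count-reverse c (d ∷ x) = begin
  count c (reverse (d ∷ x))            ≡⟨ cong (count c) (unfold-reverse d x) ⟩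
  count c (reverse x ++ [ d ])          ≡⟨ count-++ c (reverse x) [ d ] ⟩
  count c (reverse x) + count c [ d ]   ≡⟨ cong (_+ count c [ d ]) (count-reverse c x) ⟩
  count c x + count c [ d ]             ≡⟨ +-comm (count c x) (count c [ d ]) ⟩
  count c [ d ] + count c x             ≡⟨ count-++ c [ d ] x ⟨
  count c (d ∷ x)                       ∎
  where open ≡-Reasoning

count-a+count-b : ∀ (x : Word) → count a x + count b x ≡ length x
count-a+count-b [] = refl
count-a+count-b (a ∷ x) = cong suc (count-a+count-b x)
count-a+count-b (b ∷ x) = trans (+-suc (count a x) (count b x)) (cong suc (count-a+count-b x))

count≡suc⇒nonempty : ∀ {c} x {n} → count c x ≡ suc n → 0 < length x
count≡suc⇒nonempty (_ ∷ _) _ = z<s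

parikh-≡ : ∀ (x y : Word) → length x ≡ length y → count b x ≡ count b y → parikh x ≡ parikh y
parikh-≡ x y |x|≡|y| bx≡by = cong₂ _,_ (+-cancelʳ-≡ (count b x) (count a x) (count a y) (begin
  count a x + count b x  ≡⟨ count-a+count-b x ⟩
  length x               ≡⟨ |x|≡|y| ⟩
  length y               ≡⟨ count-a+count-b y ⟨
  count a y + count b y  ≡⟨ cong (count a y +_) bx≡by ⟨
  count a y + count b x  ∎)) bx≡by
  where open ≡-Reasoning

parikh-reverse : ∀ (x : Word) → parikh (reverse x) ≡ parikh x
parikh-reverse x = cong₂ _,_ (count-reverse a x) (count-reverse b x)

-- Palindromes and the standard factorization

palindrome-wrap : ∀ c {u} → Palindrome u → Palindrome (c ∷ u ++ [ c ])
palindrome-wrap c {u} pal-u = trans (reverse-wrap c u c) (cong (λ z → c ∷ z ++ [ c ]) pal-u)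

palindrome-∷ : ∀ c r → Palindrome (c ∷ r) → r ≡ [] ⊎ ∃[ u ] Palindrome u × r ≡ u ++ [ c ]
palindrome-∷ c r pal with initLast r
... | [] = inj₁ refl
... | u ∷ʳ′ d with ∷-injective (trans (sym (reverse-wrap c u d)) pal)
...   | refl , ru++c≡u++c = inj₂ (u , ∷ʳ-injectiveˡ (reverse u) u ru++c≡u++c , refl)

palindrome-middle : ∀ c d {u t} → Palindrome u → Palindrome (u ++ c ∷ d ∷ t) →
  u ++ c ∷ d ∷ t ≡ t ++ d ∷ c ∷ u → Palindrome t
palindrome-middle c d {u} {t} pal-u pal-ucdt ucdt≡tdcu = ++-cancelʳ (d ∷ c ∷ u) (reverse t) t (begin
  reverse t ++ d ∷ c ∷ u          ≡⟨ cong (λ z → reverse t ++ d ∷ c ∷ z) pal-u ⟨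
  reverse t ++ d ∷ c ∷ reverse u  ≡⟨ reverse-++-∷-∷ u c d t ⟨
  reverse (u ++ c ∷ d ∷ t)        ≡⟨ pal-ucdt ⟩
  u ++ c ∷ d ∷ t                  ≡⟨ ucdt≡tdcu ⟩
  t ++ d ∷ c ∷ u                  ∎)
  where open ≡-Reasoning

ProductOfPalindromes : Word → Set
ProductOfPalindromes w = ∃[ p ] ∃[ q ] Palindrome p × Palindrome q × w ≡ p ++ q

christoffel : ∀ {m} → Palindrome m → ProductOfPalindromes (a ∷ m ++ [ b ]) →
  IsLowerChristoffel (a ∷ m ++ [ b ])
christoffel {m} pal-m prod = inj₂ (inj₂ (m , pal-m , refl , prod))

-- u ab v = v ba u makes one of u, v a prefix of the other; removing it is the subtractive
-- Euclidean algorithm on (length u + 2, length v + 2).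
christoffel-pair : ∀ {u v} → Palindrome u → Palindrome v → u ++ a ∷ b ∷ v ≡ v ++ b ∷ a ∷ u →
  ProductOfPalindromes (a ∷ u ++ [ b ]) × ProductOfPalindromes (a ∷ v ++ [ b ])
christoffel-pair {u} {v} = go u v (<-wellFounded (length u + length v))
  where
  shorter : ∀ (x y : Word) c d → length y < length (x ++ c ∷ d ∷ y)
  shorter x y c d = subst (length y <_) (sym (length-++ x))
    (≤-trans (n≤1+n (suc (length y))) (m≤n+m _ (length x)))

  go : ∀ u v → Acc _<_ (length u + length v) → Palindrome u → Palindrome v →
    u ++ a ∷ b ∷ v ≡ v ++ b ∷ a ∷ u →
    ProductOfPalindromes (a ∷ u ++ [ b ]) × ProductOfPalindromes (a ∷ v ++ [ b ])
  go u v (acc smaller) pal-u pal-v eq with ++-overlap u (a ∷ b ∷ v) v (b ∷ a ∷ u) eq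
  ... | inj₁ ([] , _ , ())
  ... | inj₁ (b ∷ _ , _ , ())
  ... | inj₁ (a ∷ a ∷ _ , _ , ())
  ... | inj₁ (a ∷ [] , refl , eq′) =
    (a ∷ u , [ b ] , pal-au , refl , refl) ,
    (a ∷ u ++ [ a ] , [ b ] , palindrome-wrap a pal-u , refl , refl)
    where
    pal-au : Palindrome (a ∷ u)
    pal-au = trans (unfold-reverse a u)
      (trans (cong (_∷ʳ a) pal-u) (∷-injectiveʳ (∷-injectiveʳ eq′)))
  ... | inj₁ (a ∷ b ∷ t , refl , eq′) =
    proj₁ (go u t (smaller (+-monoʳ-< (length u) (shorter u t a b))) pal-u pal-t uabt≡tbau) ,
    (a ∷ u ++ [ a ] , b ∷ t ++ [ b ] , palindrome-wrap a pal-u , palindrome-wrap b pal-t ,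
      cong (a ∷_) (++-∷-∷-regroup u a b t))
    where
    uabt≡tbau : u ++ a ∷ b ∷ t ≡ t ++ b ∷ a ∷ u
    uabt≡tbau = ∷-injectiveʳ (∷-injectiveʳ eq′)
    pal-t : Palindrome t
    pal-t = palindrome-middle a b pal-u pal-v uabt≡tbau
  ... | inj₂ ([] , _ , ())
  ... | inj₂ (a ∷ _ , _ , ())
  ... | inj₂ (b ∷ b ∷ _ , _ , ())
  ... | inj₂ (b ∷ [] , refl , eq′) =
    ([ a ] , b ∷ v ++ [ b ] , refl , palindrome-wrap b pal-v , cong (λ z → a ∷ z ++ [ b ]) vb≡bv) ,
    ([ a ] , v ++ [ b ] , refl , pal-u , refl)
    where
    vb≡bv : v ++ [ b ] ≡ b ∷ v
    vb≡bv = ∷-injectiveʳ (∷-injectiveʳ eq′)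
  ... | inj₂ (b ∷ a ∷ t , refl , eq′) =
    (a ∷ t ++ [ a ] , b ∷ v ++ [ b ] , palindrome-wrap a pal-t , palindrome-wrap b pal-v ,
      cong (a ∷_) (trans (cong (_++ [ b ]) vbat≡tabv) (++-∷-∷-regroup t a b v))) ,
    proj₂ (go t v (smaller (+-monoˡ-< (length v) (shorter v t b a))) pal-t pal-v (sym vbat≡tabv))
    where
    vbat≡tabv : v ++ b ∷ a ∷ t ≡ t ++ a ∷ b ∷ v
    vbat≡tabv = ∷-injectiveʳ (∷-injectiveʳ eq′)
    pal-t : Palindrome t
    pal-t = palindrome-middle b a pal-v pal-u vbat≡tabv

ChristoffelFactorization : Word → Set
ChristoffelFactorization w = ∃[ x ] ∃[ y ] IsLowerChristoffel x × IsLowerChristoffel y × w ≡ x ++ y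

palindromic-factors : ∀ {m p q} → Palindrome m → Palindrome p → Palindrome q →
  a ∷ m ++ [ b ] ≡ p ++ q → ∃[ p′ ] ∃[ q′ ] p ≡ a ∷ p′ × q ≡ b ∷ q′
palindromic-factors {m} {p} {q} pal-m pal-p pal-q eq = go p q eq reversed
  where
  reversed : q ++ p ≡ b ∷ m ++ [ a ]
  reversed = begin
    q ++ p                      ≡⟨ cong₂ _++_ pal-q pal-p ⟨
    reverse q ++ reverse p      ≡⟨ reverse-++ p q ⟨
    reverse (p ++ q)            ≡⟨ cong reverse eq ⟨
    reverse (a ∷ m ++ [ b ])    ≡⟨ reverse-wrap a m b ⟩
    b ∷ reverse m ++ [ a ]      ≡⟨ cong (λ z → b ∷ z ++ [ a ]) pal-m ⟩
    b ∷ m ++ [ a ]              ∎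
    where open ≡-Reasoning
  go : ∀ p q → a ∷ m ++ [ b ] ≡ p ++ q → q ++ p ≡ b ∷ m ++ [ a ] →
    ∃[ p′ ] ∃[ q′ ] p ≡ a ∷ p′ × q ≡ b ∷ q′
  go [] q refl qp≡ with () ← ∷-injectiveˡ qp≡
  go (a ∷ p′) [] _ qp≡ with () ← ∷-injectiveˡ qp≡
  go (a ∷ p′) (b ∷ q′) _ _ = p′ , q′ , refl , refl
  go (b ∷ p′) q () _
  go (a ∷ p′) (a ∷ q′) _ ()

christoffel-factorization : ∀ {m} → Palindrome m → ProductOfPalindromes (a ∷ m ++ [ b ]) →
  ChristoffelFactorization (a ∷ m ++ [ b ])
christoffel-factorization {m} pal-m (p , q , pal-p , pal-q , eq)
  with palindromic-factors pal-m pal-p pal-q eq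
... | p′ , q′ , refl , refl with palindrome-∷ a p′ pal-p | palindrome-∷ b q′ pal-q
...   | inj₁ refl | inj₁ refl = [ a ] , [ b ] , inj₁ refl , inj₂ (inj₁ refl) , eq
...   | inj₁ refl | inj₂ (v , pal-v , refl) =
  a ∷ v ++ [ b ] , [ b ] ,
  christoffel pal-v ([ a ] , v ++ [ b ] , refl , subst Palindrome m≡vb pal-m , refl) , inj₂ (inj₁ refl) ,
  cong (λ z → a ∷ z ++ [ b ]) m≡vb
  where
  m≡vb : m ≡ v ++ [ b ]
  m≡vb = begin
    m                    ≡⟨ pal-m ⟨
    reverse m            ≡⟨ cong reverse (wrap-injective {x = m} {b ∷ v} eq) ⟩
    reverse (b ∷ v)      ≡⟨ unfold-reverse b v ⟩
    reverse v ++ [ b ]   ≡⟨ cong (_∷ʳ b) pal-v ⟩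
    v ++ [ b ]           ∎
    where open ≡-Reasoning
...   | inj₂ (u , pal-u , refl) | inj₁ refl =
  [ a ] , a ∷ u ++ [ b ] ,
  inj₁ refl , christoffel pal-u (a ∷ u , [ b ] , subst Palindrome m≡au pal-m , refl , refl) ,
  cong (λ z → a ∷ z ++ [ b ]) m≡au
  where
  m≡au : m ≡ a ∷ u
  m≡au = begin
    m                    ≡⟨ pal-m ⟨
    reverse m            ≡⟨ cong reverse (wrap-injective eq) ⟩
    reverse (u ++ [ a ]) ≡⟨ reverse-++ u [ a ] ⟩
    a ∷ reverse u        ≡⟨ cong (a ∷_) pal-u ⟩
    a ∷ u                ∎
    where open ≡-Reasoning
...   | inj₂ (u , pal-u , refl) | inj₂ (v , pal-v , refl) =
  a ∷ v ++ [ b ] , a ∷ u ++ [ b ] ,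
  christoffel pal-v (proj₂ halves) , christoffel pal-u (proj₁ halves) ,
  cong (a ∷_) (begin
    m ++ [ b ]                         ≡⟨ cong (_++ [ b ]) (trans m≡uabv uabv≡vbau) ⟩
    (v ++ b ∷ a ∷ u) ++ [ b ]          ≡⟨ ++-assoc v (b ∷ a ∷ u) [ b ] ⟩
    v ++ b ∷ a ∷ u ++ [ b ]            ≡⟨ ++-assoc v [ b ] (a ∷ u ++ [ b ]) ⟨
    (v ++ [ b ]) ++ a ∷ u ++ [ b ]     ∎)
  where
  open ≡-Reasoning
  m≡uabv : m ≡ u ++ a ∷ b ∷ v
  m≡uabv = wrap-injective (trans eq (cong (a ∷_) (sym (++-∷-∷-regroup u a b v))))
  uabv≡vbau : u ++ a ∷ b ∷ v ≡ v ++ b ∷ a ∷ u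
  uabv≡vbau = begin
    u ++ a ∷ b ∷ v                   ≡⟨ m≡uabv ⟨
    m                                ≡⟨ pal-m ⟨
    reverse m                        ≡⟨ cong reverse m≡uabv ⟩
    reverse (u ++ a ∷ b ∷ v)         ≡⟨ reverse-++-∷-∷ u a b v ⟩
    reverse v ++ b ∷ a ∷ reverse u   ≡⟨ cong₂ (λ x y → x ++ b ∷ a ∷ y) pal-v pal-u ⟩
    v ++ b ∷ a ∷ u                   ∎
  halves : ProductOfPalindromes (a ∷ u ++ [ b ]) × ProductOfPalindromes (a ∷ v ++ [ b ])
  halves = christoffel-pair pal-u pal-v uabv≡vbau

-- Almost additive functions

WithinOne : ℕ → ℕ → Set
WithinOne m n = m ≤ n × n ≤ suc m

withinOne-refl : ∀ {m n} → m ≡ n → WithinOne m n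
withinOne-refl refl = ≤-refl , n≤1+n _

withinOne-suc : ∀ {m n} → n ≡ suc m → WithinOne m n
withinOne-suc refl = n≤1+n _ , ≤-refl

withinOne-flip : ∀ {m n} → WithinOne m n → WithinOne n (suc m)
withinOne-flip (m≤n , n≤1+m) = n≤1+m , s≤s m≤n

withinOne-+ˡ : ∀ c {m n} → WithinOne m n → WithinOne (c + m) (c + n)
withinOne-+ˡ c {m} {n} (m≤n , n≤1+m) =
  +-monoʳ-≤ c m≤n , subst (c + n ≤_) (+-suc c m) (+-monoʳ-≤ c n≤1+m)

withinOne-cancel-+ˡ : ∀ c {m n} → WithinOne (c + m) (c + n) → WithinOne m n
withinOne-cancel-+ˡ c {m} {n} (c+m≤c+n , c+n≤1+c+m) =
  +-cancelˡ-≤ c m n c+m≤c+n , +-cancelˡ-≤ c n (suc m) (subst (c + n ≤_) (sym (+-suc c m)) c+n≤1+c+m)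

withinOne-cases : ∀ {m n} → WithinOne m n → n ≡ m ⊎ n ≡ suc m
withinOne-cases (m≤n , n≤1+m) with m≤n⇒m<n∨m≡n m≤n
... | inj₁ m<n = inj₂ (≤-antisym n≤1+m m<n)
... | inj₂ m≡n = inj₁ (sym m≡n)

AlmostAdditive : (ℕ → ℕ) → ℕ → Set
AlmostAdditive h n = ∀ i j → i + j ≤ n → WithinOne (h i + h j) (h (i + j))

-- For the heights of a word: each proper suffix has one more b than the prefix of equal length.
Complementary : (ℕ → ℕ) → ℕ → Set
Complementary h n = ∀ i j → 0 < i → 0 < j → i + j ≡ n → h n ≡ suc (h i + h j)

almostAdditive⇒zero : ∀ {h n} → AlmostAdditive h n → h 0 ≡ 0
almostAdditive⇒zero {h} aa = n≤0⇒n≡0 (+-cancelʳ-≤ (h 0) (h 0) 0 (proj₁ (aa 0 0 z≤n)))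

almostAdditive-≤ : ∀ {h n} →
  (∀ i j → i ≤ j → i + j ≤ n → WithinOne (h i + h j) (h (i + j))) → AlmostAdditive h n
almostAdditive-≤ {h} {n} wlog i j i+j≤n with ≤-total i j
... | inj₁ i≤j = wlog i j i≤j i+j≤n
... | inj₂ j≤i = subst₂ WithinOne (+-comm (h j) (h i)) (cong h (+-comm j i))
                   (wlog j i j≤i (subst (_≤ n) (+-comm i j) i+j≤n))

almostAdditive-cong : ∀ {h h′ n} → (∀ k → k ≤ n → h k ≡ h′ k) →
  AlmostAdditive h n → AlmostAdditive h′ n
almostAdditive-cong {h} {h′} {n} h≗h′ aa i j i+j≤n =
  subst₂ WithinOne
    (cong₂ _+_ (h≗h′ i (m+n≤o⇒m≤o i i+j≤n)) (h≗h′ j (m+n≤o⇒n≤o i i+j≤n)))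
    (h≗h′ (i + j) i+j≤n)
    (aa i j i+j≤n)

complementary-cong : ∀ {h h′ n} → (∀ k → k ≤ n → h k ≡ h′ k) →
  Complementary h n → Complementary h′ n
complementary-cong {h} {h′} {n} h≗h′ comp i j 0<i 0<j i+j≡n = begin
  h′ n                 ≡⟨ h≗h′ n ≤-refl ⟨
  h n                  ≡⟨ comp i j 0<i 0<j i+j≡n ⟩
  suc (h i + h j)      ≡⟨ cong suc (cong₂ _+_ (h≗h′ i i≤n) (h≗h′ j j≤n)) ⟩
  suc (h′ i + h′ j)    ∎
  where
  open ≡-Reasoning
  i≤n : i ≤ n
  i≤n = subst (i ≤_) i+j≡n (m≤m+n i j)
  j≤n : j ≤ n
  j≤n = subst (j ≤_) i+j≡n (m≤n+m j i)

almostAdditive-1 : ∀ {h} → h 0 ≡ 0 → AlmostAdditive h 1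
almostAdditive-1 {h} h0 zero j _ = withinOne-refl (cong (_+ h j) h0)
almostAdditive-1 {h} h0 (suc zero) zero _ = withinOne-refl (trans (cong (h 1 +_) h0) (+-identityʳ (h 1)))
almostAdditive-1 h0 (suc zero) (suc j) (s≤s ())
almostAdditive-1 h0 (suc (suc i)) j (s≤s ())

complementary-1 : ∀ {h} → Complementary h 1
complementary-1 (suc zero) (suc j) _ _ ()
complementary-1 (suc (suc i)) (suc j) _ _ ()

-- h and g play the heights of x y and of y, where m = length x and n = length y.
module _ {h g : ℕ → ℕ} {m n : ℕ}
         (shift : ∀ j → h (m + j) ≡ h m + g j)
         (aa-m : AlmostAdditive h m) (comp-m : Complementary h m)
         (aa-n : AlmostAdditive g n) (comp-n : Complementary g n)
         (comp-m+n : Complementary h (m + n)) where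

  private
    h0 : h 0 ≡ 0
    h0 = almostAdditive⇒zero {h} aa-m

    g0 : g 0 ≡ 0
    g0 = almostAdditive⇒zero {g} aa-n

  agrees-below : ∀ i → i < n → g i ≡ h i
  agrees-below zero _ = trans g0 (sym h0)
  agrees-below i@(suc _) i<n with m≤n⇒∃[o]m+o≡n i<n
  ... | o , 1+i+o≡n = +-cancelˡ-≡ (h m + g e) (g i) (h i) (suc-injective (begin
      suc (h m + g e + g i)    ≡⟨ cong suc (+-assoc (h m) (g e) (g i)) ⟩
      suc (h m + (g e + g i))  ≡⟨ +-suc (h m) (g e + g i) ⟨
      h m + suc (g e + g i)    ≡⟨ cong (h m +_) (comp-n e i z<s z<s e+i≡n) ⟨
      h m + g n                ≡⟨ shift n ⟨
      h (m + n)                ≡⟨ comp-m+n (m + e) i (<-≤-trans z<s (m≤n+m e m)) z<s m+e+i≡m+n ⟩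
      suc (h (m + e) + h i)    ≡⟨ cong (λ x → suc (x + h i)) (shift e) ⟩
      suc (h m + g e + h i)    ∎))
    where
    open ≡-Reasoning
    e : ℕ
    e = suc o
    e+i≡n : e + i ≡ n
    e+i≡n = trans (cong suc (+-comm o i)) 1+i+o≡n
    m+e+i≡m+n : m + e + i ≡ m + n
    m+e+i≡m+n = trans (+-assoc m e i) (cong (m +_) e+i≡n)

  almostAdditive-beyond : ∀ i j → m ≤ j → i + j < m + n → WithinOne (h i + h j) (h (i + j))
  almostAdditive-beyond i j m≤j i+j<m+n with m≤n⇒∃[o]m+o≡n m≤j
  ... | j′ , m+j′≡j =
    subst₂ WithinOne lower upper (withinOne-+ˡ (h m) (aa-n i j′ (<⇒≤ i+j′<n)))
    where
    open ≡-Reasoning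
    m+[i+j′]≡i+j : m + (i + j′) ≡ i + j
    m+[i+j′]≡i+j = trans (x∙yz≈y∙xz m i j′) (cong (i +_) m+j′≡j)
    i+j′<n : i + j′ < n
    i+j′<n = +-cancelˡ-< m (i + j′) n (subst (_< m + n) (sym m+[i+j′]≡i+j) i+j<m+n)
    lower : h m + (g i + g j′) ≡ h i + h j
    lower = begin
      h m + (g i + g j′)  ≡⟨ x∙yz≈y∙xz (h m) (g i) (g j′) ⟩
      g i + (h m + g j′)  ≡⟨ cong₂ _+_ (agrees-below i (≤-<-trans (m≤m+n i j′) i+j′<n)) (sym (shift j′)) ⟩
      h i + h (m + j′)    ≡⟨ cong (λ k → h i + h k) m+j′≡j ⟩
      h i + h j           ∎
    upper : h m + g (i + j′) ≡ h (i + j)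
    upper = trans (sym (shift (i + j′))) (cong h m+[i+j′]≡i+j)

  almostAdditive-straddle : ∀ i j → 0 < i → i < m → j ≤ m → m ≤ i + j → i + j < m + n →
    WithinOne (h i + h j) (h (i + j))
  almostAdditive-straddle i j 0<i i<m j≤m m≤i+j i+j<m+n
    with m≤n⇒∃[o]m+o≡n i<m | m≤n⇒∃[o]m+o≡n m≤i+j
  ... | o , 1+i+o≡m | e , m+e≡i+j =
    subst (WithinOne (h i + h j)) h[i+j]
      (withinOne-+ˡ (h i) (withinOne-flip (subst (WithinOne (h d + h e)) (cong h d+e≡j)
        (aa-m d e (subst (_≤ m) (sym d+e≡j) j≤m)))))
    where
    open ≡-Reasoning
    d : ℕ
    d = suc o
    i+d≡m : i + d ≡ m
    i+d≡m = trans (+-suc i o) 1+i+o≡m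
    d+e≡j : d + e ≡ j
    d+e≡j = +-cancelˡ-≡ i (d + e) j (begin
      i + (d + e)  ≡⟨ +-assoc i d e ⟨
      i + d + e    ≡⟨ cong (_+ e) i+d≡m ⟩
      m + e        ≡⟨ m+e≡i+j ⟩
      i + j        ∎)
    e<n : e < n
    e<n = +-cancelˡ-< m e n (subst (_< m + n) (sym m+e≡i+j) i+j<m+n)
    h[i+j] : h i + suc (h d + h e) ≡ h (i + j)
    h[i+j] = begin
      h i + suc (h d + h e)  ≡⟨ +-suc (h i) (h d + h e) ⟩
      suc (h i + (h d + h e))  ≡⟨ cong suc (+-assoc (h i) (h d) (h e)) ⟨
      suc (h i + h d) + h e  ≡⟨ cong₂ _+_ (comp-m i d 0<i z<s i+d≡m) (agrees-below e e<n) ⟨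
      h m + g e              ≡⟨ shift e ⟨
      h (m + e)              ≡⟨ cong h m+e≡i+j ⟩
      h (i + j)              ∎

  almostAdditive-join : AlmostAdditive h (m + n)
  almostAdditive-join = almostAdditive-≤ {h} bounds
    where
    bounds : ∀ i j → i ≤ j → i + j ≤ m + n → WithinOne (h i + h j) (h (i + j))
    bounds zero j _ _ = withinOne-refl (cong (_+ h j) h0)
    bounds i@(suc _) j i≤j i+j≤m+n with i + j ≟ m + n | i + j ≤? m | m ≤? j
    ... | yes i+j≡m+n | _ | _ =
      withinOne-suc (trans (cong h i+j≡m+n) (comp-m+n i j z<s (<-≤-trans z<s i≤j) i+j≡m+n))
    ... | no _ | yes i+j≤m | _ = aa-m i j i+j≤m
    ... | no i+j≢m+n | no _ | yes m≤j = almostAdditive-beyond i j m≤j (≤∧≢⇒< i+j≤m+n i+j≢m+n)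
    ... | no i+j≢m+n | no i+j≰m | no m≰j =
      almostAdditive-straddle i j z<s (≤-<-trans i≤j j<m) (<⇒≤ j<m) (<⇒≤ (≰⇒> i+j≰m)) (≤∧≢⇒< i+j≤m+n i+j≢m+n)
      where
      j<m : j < m
      j<m = ≰⇒> m≰j

-- Heights of Christoffel words

height : Word → ℕ → ℕ
height w i = count b (take i w)

height-++-≤ : ∀ x y {k} → k ≤ length x → height (x ++ y) k ≡ height x k
height-++-≤ x y {k} k≤x = cong (count b) (take-++-≤ k x y k≤x)

height-++-+ : ∀ x y j → height (x ++ y) (length x + j) ≡ count b x + height y j
height-++-+ x y j = trans (cong (count b) (take-++-+ x y j)) (count-++ b x (take j y))

height-length-++ : ∀ x y → height (x ++ y) (length x) ≡ count b x
height-length-++ x y = cong (count b) (take-length-++ x y)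

height-length : ∀ w → height w (length w) ≡ count b w
height-length w = cong (count b) (take-all (length w) w ≤-refl)

christoffel-nonempty : ∀ {w} → IsLowerChristoffel w → 0 < length w
christoffel-nonempty (inj₁ refl) = z<s
christoffel-nonempty (inj₂ (inj₁ refl)) = z<s
christoffel-nonempty (inj₂ (inj₂ (_ , _ , refl , _))) = z<s

complementary-at-split : ∀ α β → Palindrome (α ++ β) →
  let w = a ∷ (α ++ β) ++ [ b ] in
  height w (length w) ≡ suc (height w (suc (length α)) + height w (suc (length β)))
complementary-at-split α β pal = begin
  height w (length w)                     ≡⟨ height-length w ⟩
  count b ((α ++ β) ++ [ b ])             ≡⟨ count-++ b (α ++ β) [ b ] ⟩
  count b (α ++ β) + 1                    ≡⟨ +-comm (count b (α ++ β)) 1 ⟩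
  suc (count b (α ++ β))                  ≡⟨ cong suc (count-++ b α β) ⟩
  suc (count b α + count b β)             ≡⟨ cong suc (cong₂ _+_ prefix-α prefix-β) ⟨
  suc (height w (suc (length α)) + height w (suc (length β)))  ∎
  where
  open ≡-Reasoning
  w : Word
  w = a ∷ (α ++ β) ++ [ b ]
  prefix-α : height ((α ++ β) ++ [ b ]) (length α) ≡ count b α
  prefix-α = trans (cong (λ z → height z (length α)) (++-assoc α β [ b ]))
                   (height-length-++ α (β ++ [ b ]))
  reversed : (α ++ β) ++ [ b ] ≡ reverse β ++ reverse α ++ [ b ]
  reversed = trans (cong (_++ [ b ]) (trans (sym pal) (reverse-++ α β)))
                   (++-assoc (reverse β) (reverse α) [ b ])
  prefix-β : height ((α ++ β) ++ [ b ]) (length β) ≡ count b β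
  prefix-β = begin
    height ((α ++ β) ++ [ b ]) (length β)
      ≡⟨ cong₂ height reversed (sym (length-reverse β)) ⟩
    height (reverse β ++ reverse α ++ [ b ]) (length (reverse β))
      ≡⟨ height-length-++ (reverse β) (reverse α ++ [ b ]) ⟩
    count b (reverse β)
      ≡⟨ count-reverse b β ⟩
    count b β
      ∎

complementary-christoffel : ∀ {w} → IsLowerChristoffel w → Complementary (height w) (length w)
complementary-christoffel (inj₁ refl) = complementary-1 {height [ a ]}
complementary-christoffel (inj₂ (inj₁ refl)) = complementary-1 {height [ b ]}
complementary-christoffel (inj₂ (inj₂ (m , pal-m , refl , _))) (suc i) (suc j) _ _ eq
  with suc-injective (trans (sym (+-suc i j)) (suc-injective (trans eq (length-wrap a m b))))
... | i+j≡m with splitAt-≤ i m (subst (i ≤_) i+j≡m (m≤m+n i j))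
...   | α , β , refl , refl
  rewrite +-cancelˡ-≡ (length α) j (length β) (trans i+j≡m (length-++ α)) =
  complementary-at-split α β pal-m

almostAdditive-++ : ∀ x y →
  AlmostAdditive (height x) (length x) → Complementary (height x) (length x) →
  AlmostAdditive (height y) (length y) → Complementary (height y) (length y) →
  Complementary (height (x ++ y)) (length (x ++ y)) →
  AlmostAdditive (height (x ++ y)) (length (x ++ y))
almostAdditive-++ x y aa-x comp-x aa-y comp-y comp-xy =
  subst (AlmostAdditive (height (x ++ y))) (sym (length-++ x))
    (almostAdditive-join {height (x ++ y)} {height y} {length x} {length y} shift
      (almostAdditive-cong agree aa-x) (complementary-cong agree comp-x) aa-y comp-y
      (subst (Complementary (height (x ++ y))) (length-++ x) comp-xy))
  where
  shift : ∀ j → height (x ++ y) (length x + j) ≡ height (x ++ y) (length x) + height y j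
  shift j = trans (height-++-+ x y j) (cong (_+ height y j) (sym (height-length-++ x y)))
  agree : ∀ k → k ≤ length x → height x k ≡ height (x ++ y) k
  agree k k≤x = sym (height-++-≤ x y k≤x)

almostAdditive-christoffel : ∀ {w} → IsLowerChristoffel w → AlmostAdditive (height w) (length w)
almostAdditive-christoffel {w} = go w (<-wellFounded (length w))
  where
  go : ∀ w → Acc _<_ (length w) → IsLowerChristoffel w → AlmostAdditive (height w) (length w)
  go _ _ (inj₁ refl) = almostAdditive-1 {height [ a ]} refl
  go _ _ (inj₂ (inj₁ refl)) = almostAdditive-1 {height [ b ]} refl
  go _ (acc smaller) chr@(inj₂ (inj₂ (m , pal-m , refl , prod)))
    with christoffel-factorization pal-m prod
  ... | x , y , chr-x , chr-y , w≡xy =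
    subst (λ z → AlmostAdditive (height z) (length z)) (sym w≡xy)
      (almostAdditive-++ x y
        (go x (smaller x<w) chr-x) (complementary-christoffel chr-x)
        (go y (smaller y<w) chr-y) (complementary-christoffel chr-y)
        (subst (λ z → Complementary (height z) (length z)) w≡xy (complementary-christoffel chr)))
    where
    |w|≡|x|+|y| : length (a ∷ m ++ [ b ]) ≡ length x + length y
    |w|≡|x|+|y| = trans (cong length w≡xy) (length-++ x)
    x<w : length x < length (a ∷ m ++ [ b ])
    x<w = subst (length x <_) (sym |w|≡|x|+|y|) (m<m+n (length x) (christoffel-nonempty chr-y))
    y<w : length y < length (a ∷ m ++ [ b ])
    y<w = subst (length y <_) (sym |w|≡|x|+|y|) (m<n+m (length y) (christoffel-nonempty chr-x))

count-suffix : ∀ y z → Complementary (height (y ++ z)) (length (y ++ z)) →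
  0 < length y → 0 < length z → count b z ≡ suc (height (y ++ z) (length z))
count-suffix y z comp 0<y 0<z =
  +-cancelˡ-≡ (count b y) (count b z) (suc (height (y ++ z) (length z))) (begin
    count b y + count b z                          ≡⟨ count-++ b y z ⟨
    count b (y ++ z)                               ≡⟨ height-length (y ++ z) ⟨
    height (y ++ z) (length (y ++ z))              ≡⟨ comp (length y) (length z) 0<y 0<z (sym (length-++ y)) ⟩
    suc (height (y ++ z) (length y) + height (y ++ z) (length z))
      ≡⟨ cong (λ n → suc (n + height (y ++ z) (length z))) (height-length-++ y z) ⟩
    suc (count b y + height (y ++ z) (length z))   ≡⟨ +-suc (count b y) (height (y ++ z) (length z)) ⟨
    count b y + suc (height (y ++ z) (length z))   ∎)
  where open ≡-Reasoning

height-reverse : ∀ w k → Complementary (height w) (length w) → 0 < k → k < length w →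
  height (reverse w) k ≡ suc (height w k)
height-reverse w k comp 0<k k<w with splitAt-≤ (length w ∸ k) w (m∸n≤m (length w) k)
... | y , z , refl , |y|≡|w|∸k = begin
  height (reverse (y ++ z)) k                          ≡⟨ cong₂ height (reverse-++ y z) (sym |rz|≡k) ⟩
  height (reverse z ++ reverse y) (length (reverse z)) ≡⟨ height-length-++ (reverse z) (reverse y) ⟩
  count b (reverse z)                                  ≡⟨ count-reverse b z ⟩
  count b z                                            ≡⟨ count-suffix y z comp 0<y 0<z ⟩
  suc (height (y ++ z) (length z))                     ≡⟨ cong (λ i → suc (height (y ++ z) i)) |z|≡k ⟩
  suc (height (y ++ z) k)                              ∎
  where
  open ≡-Reasoning
  |z|≡k : length z ≡ k
  |z|≡k = +-cancelˡ-≡ (length y) (length z) k (begin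
    length y + length z            ≡⟨ length-++ y ⟨
    length (y ++ z)                ≡⟨ m∸n+n≡m (<⇒≤ k<w) ⟨
    length (y ++ z) ∸ k + k        ≡⟨ cong (_+ k) |y|≡|w|∸k ⟨
    length y + k                   ∎)
  |rz|≡k : length (reverse z) ≡ k
  |rz|≡k = trans (length-reverse z) |z|≡k
  0<y : 0 < length y
  0<y = subst (0 <_) (sym |y|≡|w|∸k) (m<n⇒0<n∸m k<w)
  0<z : 0 < length z
  0<z = subst (0 <_) (sym |z|≡k) 0<k

-- Factors and lattice points

infix∈allFactors : ∀ (α x β : Word) → x ∈ allFactors (α ++ x ++ β)
infix∈allFactors α x β = ∈-concat⁺′ (++∈inits x β) (∈-map⁺ inits (++∈tails α (x ++ β)))

∈allFactors⇒infix : ∀ {x} w → x ∈ allFactors w → ∃[ α ] ∃[ β ] w ≡ α ++ x ++ β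
∈allFactors⇒infix w x∈ with ∈-concat⁻′ (map inits (tails w)) x∈
... | _ , x∈inits , inits∈ with ∈-map⁻ inits inits∈
...   | t , t∈tails , refl with ∈tails⇒++ w t∈tails | ∈inits⇒++ t x∈inits
...     | α , refl | β , refl = α , β , refl

parikh≟ : ∀ (v : ℕ × ℕ) (x : Word) → Dec (parikh x ≡ v)
parikh≟ v x = ×-≡-dec _≟_ _≟_ (parikh x) v

δ-positive : ∀ {w x} → x ∈ allFactors w → 0 < δ w (count a x) (count b x)
δ-positive {w} {x} x∈ = nonempty (∈-filter⁺ (parikh≟ (parikh x)) x∈ refl)
  where
  nonempty : ∀ {xs : List Word} → x ∈ xs → 0 < length (deduplicate _≟W_ xs)
  nonempty {_ ∷ _} _ = z<s

δ-positive⁻ : ∀ {w i j} → 0 < δ w i j → ∃[ x ] x ∈ allFactors w × parikh x ≡ (i , j)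
δ-positive⁻ {w} {i} {j} δ>0 with filter (parikh≟ (i , j)) (allFactors w) in eq
... | x ∷ _ = x , ∈-filter⁻ (parikh≟ (i , j)) (subst (x ∈_) (sym eq) (here refl))

factor-withinOne : ∀ α x β → AlmostAdditive (height (α ++ x ++ β)) (length (α ++ x ++ β)) →
  WithinOne (height (α ++ x ++ β) (length x)) (count b x)
factor-withinOne α x β aa = withinOne-cancel-+ˡ (count b α)
  (subst₂ WithinOne (cong (_+ height (α ++ x ++ β) (length x)) (height-length-++ α (x ++ β))) h[α+x]
    (aa (length α) (length x) (length-infix α x β)))
  where
  h[α+x] : height (α ++ x ++ β) (length α + length x) ≡ count b α + count b x
  h[α+x] = trans (height-++-+ α (x ++ β) (length x)) (cong (λ n → count b α + n) (height-length-++ x β))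

factor-shorter : ∀ α x β → count b x ≢ height (α ++ x ++ β) (length x) →
  length x < length (α ++ x ++ β)
factor-shorter [] x β ≢ = contradiction (sym (height-length-++ x β)) ≢
factor-shorter (c ∷ α) x β _ = s≤s (≤-trans (m≤n+m (length x) (length α)) (length-infix α x β))

point : Word → ℤ × ℤ
point y = (ℤ.+ count a y , ℤ.+ count b y)

point-≡ : ∀ x {i j} → parikh x ≡ (i , j) → point x ≡ (ℤ.+ i , ℤ.+ j)
point-≡ x refl = refl

point∈pathPoints-++ : ∀ x y → point x ∈ pathPoints (x ++ y)
point∈pathPoints-++ x y = ∈-map⁺ point (++∈inits x y)

point∈pathPoints : ∀ w x → length x ≤ length w → count b x ≡ height w (length x) →
  point x ∈ pathPoints w
point∈pathPoints w x x≤w bx≡h with splitAt-≤ (length x) w x≤w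
... | y , z , refl , |y|≡|x| =
  subst (_∈ pathPoints (y ++ z)) (point-≡ y (parikh-≡ y x |y|≡|x| by≡bx)) (point∈pathPoints-++ y z)
  where
  by≡bx : count b y ≡ count b x
  by≡bx = trans (sym (height-length-++ y z)) (trans (cong (height (y ++ z)) |y|≡|x|) (sym bx≡h))

factor⇒support : ∀ w {x} → x ∈ allFactors w → InSupport w (point x)
factor⇒support w {x} x∈ = count a x , count b x , refl , δ-positive {w} x∈

factor⇒pathPoint : ∀ α x β → IsLowerChristoffel (α ++ x ++ β) → InS (α ++ x ++ β) (point x)
factor⇒pathPoint α x β chr =
  onPath (withinOne-cases (factor-withinOne α x β (almostAdditive-christoffel chr)))
  where
  w : Word
  w = α ++ x ++ β
  x≤w : length x ≤ length w
  x≤w = ≤-trans (m≤n+m (length x) (length α)) (length-infix α x β)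
  onPath : count b x ≡ height w (length x) ⊎ count b x ≡ suc (height w (length x)) → InS w (point x)
  onPath (inj₁ bx≡h) = inj₁ (point∈pathPoints w x x≤w bx≡h)
  onPath (inj₂ bx≡1+h) = inj₂ (point∈pathPoints (reverse w) x x≤rw
    (trans bx≡1+h (sym (height-reverse w (length x) (complementary-christoffel chr) 0<x x<w))))
    where
    x≤rw : length x ≤ length (reverse w)
    x≤rw = subst (length x ≤_) (sym (length-reverse w)) x≤w
    0<x : 0 < length x
    0<x = count≡suc⇒nonempty x bx≡1+h
    x<w : length x < length w
    x<w = factor-shorter α x β (λ bx≡h → 1+n≢n (trans (sym bx≡1+h) bx≡h))

pathPoint⇒support : ∀ w {p} → InS w p → InSupport w p
pathPoint⇒support w (inj₁ p∈) with ∈-map⁻ point {xs = inits w} p∈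
... | y , y∈ , refl with ∈inits⇒++ w y∈
...   | z , refl = factor⇒support (y ++ z) (infix∈allFactors [] y z)
pathPoint⇒support w (inj₂ p∈) with ∈-map⁻ point {xs = inits (reverse w)} p∈
... | y , y∈ , refl with ∈inits⇒++ (reverse w) y∈
...   | z , rw≡yz = subst (InSupport w) (point-≡ (reverse y) (parikh-reverse y))
  (factor⇒support w (subst (λ v → reverse y ∈ allFactors v) (sym w≡)
    (infix∈allFactors (reverse z) (reverse y) [])))
  where
  w≡ : w ≡ reverse z ++ reverse y ++ []
  w≡ = begin
    w                             ≡⟨ reverse-involutive w ⟨
    reverse (reverse w)           ≡⟨ cong reverse rw≡yz ⟩
    reverse (y ++ z)              ≡⟨ reverse-++ y z ⟩
    reverse z ++ reverse y        ≡⟨ cong (reverse z ++_) (++-identityʳ (reverse y)) ⟨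
    reverse z ++ reverse y ++ []  ∎
    where open ≡-Reasoning

support⇒pathPoint : ∀ {w p} → IsLowerChristoffel w → InSupport w p → InS w p
support⇒pathPoint {w} chr (i , j , refl , δ>0) with δ-positive⁻ {w} δ>0
... | x , x∈w , parikh≡ with ∈allFactors⇒infix w x∈w
...   | α , β , refl = subst (InS (α ++ x ++ β)) (point-≡ x parikh≡) (factor⇒pathPoint α x β chr)

theorem5 : (w : Word) → IsLowerChristoffel w →
    (p : ℤ × ℤ) → (InS w p → InSupport w p) × (InSupport w p → InS w p)
theorem5 w chr p = pathPoint⇒support w , support⇒pathPoint chr
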